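{- Let $G$ be a finite, simple, connected graph with $res(G)=k$. Then any two vertices of $G$ have at most $k-1$ common neighbours.
   Context: $d(x,y)$ is the distance in $G$. For an ordered set $W=\{w_1,\ldots,w_k\}\subseteq V(G)$ and $v\in V(G)$, $r(v|W)=(d(v,w_1),\ldots,d(v,w_k))$. $W$ is a resolving set if distinct vertices have distinct representations with respect to $W$. The resolving number $res(G)$ is the minimum integer $k$ such that every $k$-subset of $V(G)$ is a resolving set for $G$. -}

module Defs where

open import Data.Nat using (ℕ; zero; suc; _≤_; _<_)
open import Data.Bool using (Bool; true; false; _∧_)
open import Data.Fin using (Fin)
open import Data.Fin.Subset using (Subset; _∈_; ∣_∣)
open import Data.Vec using (tabulate)
open import Data.Product using (Σ; _×_; ∃)
open import Relation.Binary.PropositionalEquality using (_≡_)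
open import Relation.Nullary using (¬_)
open import Function.Bundles using (_⇔_)

record Graph (n : ℕ) : Set where
  field
    adj   : Fin n → Fin n → Bool
    sym   : ∀ u v → adj u v ≡ adj v u
    irrefl : ∀ u → adj u u ≡ false

module _ {n : ℕ} (G : Graph n) where
  open Graph G

  data Walk : Fin n → Fin n → ℕ → Set where
    here : ∀ {u} → Walk u u zero
    step : ∀ {u w v ℓ} → adj u w ≡ true → Walk w v ℓ → Walk u v (suc ℓ)

  Connected : Set
  Connected = ∀ u v → ∃ λ ℓ → Walk u v ℓ

  IsDist : Fin n → Fin n → ℕ → Set
  IsDist u v d = Walk u v d × (∀ ℓ → Walk u v ℓ → d ≤ ℓ)

  SameDist : Fin n → Fin n → Fin n → Set
  SameDist x y w = ∀ d → IsDist x w d ⇔ IsDist y w d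

  Resolving : Subset n → Set
  Resolving W = ∀ x y → (∀ w → w ∈ W → SameDist x y w) → x ≡ y

  AllResolving : ℕ → Set
  AllResolving k = ∀ (W : Subset n) → ∣ W ∣ ≡ k → Resolving W

  Res : ℕ → Set
  Res k = AllResolving k × (∀ j → j < k → ¬ AllResolving j)

  commonNbrs : Fin n → Fin n → Subset n
  commonNbrs u v = tabulate λ w → adj u w ∧ adj v w

-- If u ≠ v had k common neighbours, any k of them would form a k-set on which
-- u and v have the same representation (1, …, 1), so that set would not resolve G.
module Submission where

open import Defs
open import Data.Bool using (true; false; _∧_)
open import Data.Bool.Properties using (∧-conicalˡ; ∧-conicalʳ)
open import Data.Nat using (ℕ; zero; suc; _≤_; _<_; _∸_; _>_; z≤n; s≤s)
open import Data.Nat.Properties using (≤-antisym; _≤?_; ≰⇒>; suc[m]≤n⇒m≤pred[n])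
open import Data.Fin using (Fin)
open import Data.Fin.Subset using (Subset; _∈_; _⊆_; ∣_∣)
open import Data.Vec using ([]; _∷_; here; there)
open import Data.Vec.Properties using ([]=⇒lookup; lookup∘tabulate)
open import Data.Product using (Σ; _×_; _,_)
open import Data.Empty using (⊥-elim)
open import Function.Bundles using (mk⇔)
open import Relation.Nullary using (¬_; yes; no)
open import Relation.Binary.PropositionalEquality using (_≡_; _≢_; refl; sym; trans; cong; subst)

⊆-ofSize : ∀ {n} (S : Subset n) k → k ≤ ∣ S ∣ → Σ (Subset n) λ W → ∣ W ∣ ≡ k × W ⊆ S
⊆-ofSize []          zero    _       = [] , refl , λ ()
⊆-ofSize (false ∷ S) k       k≤∣S∣   with ⊆-ofSize S k k≤∣S∣
... | W , ∣W∣≡k , W⊆S = false ∷ W , ∣W∣≡k , λ { (there x∈W) → there (W⊆S x∈W) }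
⊆-ofSize (true ∷ S)  zero    _       with ⊆-ofSize S zero z≤n
... | W , ∣W∣≡0 , W⊆S = false ∷ W , ∣W∣≡0 , λ { (there x∈W) → there (W⊆S x∈W) }
⊆-ofSize (true ∷ S)  (suc k) (s≤s k≤∣S∣) with ⊆-ofSize S k k≤∣S∣
... | W , ∣W∣≡k , W⊆S = true ∷ W , cong suc ∣W∣≡k ,
      λ { here → here ; (there x∈W) → there (W⊆S x∈W) }

module _ {n : ℕ} (G : Graph n) where
  open Graph G using (adj; irrefl)

  Walk-zero⇒≡ : ∀ {u w} → Walk G u w zero → u ≡ w
  Walk-zero⇒≡ here = refl

  adj⇒≢ : ∀ {u w} → adj u w ≡ true → u ≢ w
  adj⇒≢ {u} uw refl with trans (sym uw) (irrefl u)
  ... | ()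

  IsDist-functional : ∀ {u w d e} → IsDist G u w d → IsDist G u w e → d ≡ e
  IsDist-functional (walk-d , min-d) (walk-e , min-e) = ≤-antisym (min-d _ walk-e) (min-e _ walk-d)

  adj⇒IsDist-one : ∀ {u w} → adj u w ≡ true → IsDist G u w 1
  adj⇒IsDist-one uw = step uw here , shortest
    where
    shortest : ∀ ℓ → Walk G _ _ ℓ → 1 ≤ ℓ
    shortest zero    walk = ⊥-elim (adj⇒≢ uw (Walk-zero⇒≡ walk))
    shortest (suc ℓ) _    = s≤s z≤n

  IsDist⇒SameDist : ∀ {x y w e} → IsDist G x w e → IsDist G y w e → SameDist G x y w
  IsDist⇒SameDist xw yw d = mk⇔
    (λ xw′ → subst (IsDist G _ _) (IsDist-functional xw xw′) yw)
    (λ yw′ → subst (IsDist G _ _) (IsDist-functional yw yw′) xw)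

  ∈commonNbrs⇒adj : ∀ {u v w} → w ∈ commonNbrs G u v → adj u w ≡ true × adj v w ≡ true
  ∈commonNbrs⇒adj {u} {v} {w} w∈ = ∧-conicalˡ _ _ uvw , ∧-conicalʳ _ _ uvw
    where
    uvw : adj u w ∧ adj v w ≡ true
    uvw = trans (sym (lookup∘tabulate _ w)) ([]=⇒lookup w∈)

  ⊆commonNbrs⇒¬Resolving : ∀ {u v W} → u ≢ v → W ⊆ commonNbrs G u v → ¬ Resolving G W
  ⊆commonNbrs⇒¬Resolving u≢v W⊆ resolving = u≢v (resolving _ _ λ w w∈W →
    let uw , vw = ∈commonNbrs⇒adj (W⊆ w∈W)
    in IsDist⇒SameDist (adj⇒IsDist-one uw) (adj⇒IsDist-one vw))

  AllResolving⇒∣commonNbrs∣< : ∀ {k u v} → AllResolving G k → u ≢ v → ∣ commonNbrs G u v ∣ < k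
  AllResolving⇒∣commonNbrs∣< {k} {u} {v} allResolving u≢v with k ≤? ∣ commonNbrs G u v ∣
  ... | no k≰∣C∣ = ≰⇒> k≰∣C∣
  ... | yes k≤∣C∣ with ⊆-ofSize (commonNbrs G u v) k k≤∣C∣
  ...   | W , ∣W∣≡k , W⊆C = ⊥-elim (⊆commonNbrs⇒¬Resolving u≢v W⊆C (allResolving W ∣W∣≡k))

mainTheorem10 : ∀ {n : ℕ} (G : Graph n) → n > 0 → Connected G →
    ∀ (k : ℕ) → Res G k →
    ∀ (u v : Fin n) → u ≢ v → ∣ commonNbrs G u v ∣ ≤ k ∸ 1
mainTheorem10 G _ _ k (allResolving , _) u v u≢v =
  suc[m]≤n⇒m≤pred[n] (AllResolving⇒∣commonNbrs∣< G allResolving u≢v)
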